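{- Let $G=(V,E)$ be a finite undirected graph, let $s,t$ be distinct non-adjacent nodes with $st$ node connectivity $k^{st}$, and let a palette of $n_c$ colors be available. Color $G$ by the Path-based Color Assignment: choose $k^{st}$ pairwise internally node-disjoint $s$–$t$ paths; give all nodes of each path (other than $s,t$) one common color, using pairwise distinct colors for the paths if $n_c\ge k^{st}$, and otherwise using distinct colors for $n_c$ of the paths and arbitrary colors for the remaining paths; all other nodes (including $s,t$) receive arbitrary colors. Then the value of the minimum color $st$ node cut of the resulting colored graph is $\min(k^{st},n_c)$.
   Context: The $st$ node connectivity $k^{st}$ is the minimum size of an $st$ node cut, i.e. of a set $X\subseteq V\setminus\{s,t\}$ whose removal leaves $s$ and $t$ in different connected components. In a colored graph (each node carries one color), a color $st$ node cut is a set $C_c$ of colors such that the set of nodes whose colors lie in $C_c$ (possibly including $s$ or $t$) contains an $st$ node cut; the value of the minimum color $st$ node cut is the minimum size of such a $C_c$. -}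

module Defs where

open import Data.Nat using (ℕ; _≤_; _<_)
open import Data.Bool using (Bool; T; false)
open import Data.Vec using (tabulate; lookup)
open import Data.Fin using (Fin)
open import Data.Fin.Subset using (Subset; _∈_; _∉_; ∣_∣; _⊆_)
open import Data.List using (List; _∷_; []; _++_)
open import Data.List.Relation.Unary.All using (All)
open import Data.List.Relation.Unary.Unique.Propositional using (Unique)
open import Data.List.Relation.Unary.Linked using (Linked)
import Data.List.Membership.Propositional as LM
open import Data.Product using (Σ; ∃; _×_)
open import Relation.Binary.PropositionalEquality using (_≡_; _≢_)
open import Relation.Nullary using (¬_)

record Graph (N : ℕ) : Set where
  field
    E     : Fin N → Fin N → Bool
    sym   : ∀ u v → E u v ≡ E v u
    irrefl : ∀ v → E v v ≡ false

open Graph public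

Adj : ∀ {N} → Graph N → Fin N → Fin N → Set
Adj G u v = T (E G u v)

ConnectedAvoiding : ∀ {N} → Graph N → Subset N → Fin N → Fin N → Set
ConnectedAvoiding {N} G X s t =
  Σ (List (Fin N)) λ ws → Linked (Adj G) (s ∷ ws ++ (t ∷ [])) × All (λ v → v ∉ X) ws

IsNodeCut : ∀ {N} → Graph N → Fin N → Fin N → Subset N → Set
IsNodeCut G s t X = s ∉ X × t ∉ X × ¬ ConnectedAvoiding G X s t

IsMin : (ℕ → Set) → ℕ → Set
IsMin P k = P k × (∀ m → P m → k ≤ m)

NodeConnectivity : ∀ {N} → Graph N → Fin N → Fin N → ℕ → Set
NodeConnectivity G s t k =
  IsMin (λ m → Σ (Subset _) λ X → IsNodeCut G s t X × ∣ X ∣ ≡ m) k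

colorNodes : ∀ {N nc} → (Fin N → Fin nc) → Subset nc → Subset N
colorNodes c Cc = tabulate (λ v → lookup Cc (c v))

IsColorCut : ∀ {N nc} → Graph N → Fin N → Fin N → (Fin N → Fin nc) → Subset nc → Set
IsColorCut G s t c Cc = Σ (Subset _) λ X → IsNodeCut G s t X × X ⊆ colorNodes c Cc

MinColorCutValue : ∀ {N nc} → Graph N → Fin N → Fin N → (Fin N → Fin nc) → ℕ → Set
MinColorCutValue {nc = nc} G s t c m =
  IsMin (λ j → Σ (Subset nc) λ Cc → IsColorCut G s t c Cc × ∣ Cc ∣ ≡ j) m

record STPath {N} (G : Graph N) (s t : Fin N) : Set where
  field
    inner   : List (Fin N)
    linked  : Linked (Adj G) (s ∷ inner ++ (t ∷ []))
    simple  : Unique (s ∷ inner ++ (t ∷ []))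

open STPath public

InternallyDisjoint : ∀ {N k} {G : Graph N} {s t : Fin N} → (Fin k → STPath G s t) → Set
InternallyDisjoint {N} P = ∀ i j → i ≢ j → ∀ (v : Fin N) →
  v LM.∈ inner (P i) → ¬ (v LM.∈ inner (P j))

Injective : ∀ {a b} → (Fin a → Fin b) → Set
Injective f = ∀ i j → f i ≡ f j → i ≡ j

PathBasedColoring : ∀ {N k nc} {G : Graph N} {s t : Fin N} →
  (Fin k → STPath G s t) → (Fin N → Fin nc) → Set
PathBasedColoring {N} {k} {nc} P c =
  Σ (Fin k → Fin nc) λ col →
    (∀ i (v : Fin N) → v LM.∈ inner (P i) → c v ≡ col i) ×
    ((k ≤ nc → Injective col) ×
     (nc < k → Σ (Fin nc → Fin k) λ ι → Injective ι × Injective (λ x → col (ι x))))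

module Submission where

-- Both bounds rest on one counting principle for finite subsets: if the
-- members of q are mapped injectively into p, then ∣ q ∣ ≤ ∣ p ∣.
--
-- Upper bound.  A minimum node cut X (∣ X ∣ = k) is covered by the nodes
-- whose colors lie in the image c[X]; by the counting principle (choosing
-- one preimage per color) ∣ c[X] ∣ ≤ ∣ X ∣ = k, and trivially ∣ c[X] ∣ ≤ nc.
-- Padding c[X] with further colors yields a color cut of size exactly k ⊓ nc.
--
-- Lower bound.  Any node cut meets the interior of every s–t path, so a
-- color cut D contains the common color of every path.  The path colors are
-- injective on all k paths (if k ≤ nc) or on nc selected paths (if nc < k),
-- hence the counting principle gives k ⊓ nc ≤ ∣ D ∣.

open import Defs hiding (sym)
open import Data.Nat using (ℕ; _⊓_; zero; suc; _≤_; z≤n; s≤s; _≤?_)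
open import Data.Nat.Properties
  using (≤-trans; ≤-reflexive; ≤-<-trans; ≰⇒>; m<1+n⇒m≤n; m≤n⇒m⊓n≡m; m⊓n≤n; ⊓-glb)
open import Data.Bool using (true)
open import Data.Bool.Properties using (T-≡)
open import Data.Fin using (Fin; zero; suc)
open import Data.Fin.Properties using (any?; _≟_; suc-injective; 0≢1+n)
open import Data.Fin.Subset using (Subset; _∈_; ∣_∣; _⊆_; _-_; ⊤; inside; outside)
open import Data.Fin.Subset.Properties
  using (_∈?_; ∣⊤∣≡n; ∣p∣≤n; x∈p∧x≢y⇒x∈p-y; x∈p⇒∣p-x∣<∣p∣; in⊆in; out⊆)
open import Data.Vec using ([]; _∷_; here; there; tabulate; lookup)
open import Data.Vec.Properties using ([]=⇒lookup; lookup⇒[]=; lookup∘tabulate)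
open import Data.List.Relation.Unary.All.Properties using (¬All⇒Any¬)
import Data.List.Membership.Propositional as List
open import Data.Product using (Σ; ∃; _×_; _,_; proj₁; proj₂)
open import Function using (Equivalence)
open import Relation.Binary.PropositionalEquality using (_≡_; _≢_; refl; sym; trans; cong; subst)
open import Relation.Nullary using (¬_; Dec; yes; no; contradiction)
open import Relation.Nullary.Decidable using (isYes; _×-dec_; ¬?; decidable-stable; toWitness; fromWitness)

card-≤-injection : ∀ {m n} (q : Subset m) (p : Subset n)
  (g : ∀ {i} → i ∈ q → Fin n) →
  (∀ {i} (i∈q : i ∈ q) → g i∈q ∈ p) →
  (∀ {i j} (i∈q : i ∈ q) (j∈q : j ∈ q) → g i∈q ≡ g j∈q → i ≡ j) →
  ∣ q ∣ ≤ ∣ p ∣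
card-≤-injection [] p g into inj = z≤n
card-≤-injection (outside ∷ q) p g into inj =
  card-≤-injection q p (λ i∈q → g (there i∈q)) (λ i∈q → into (there i∈q))
    (λ i∈q j∈q e → suc-injective (inj (there i∈q) (there j∈q) e))
card-≤-injection (inside ∷ q) p g into inj =
  ≤-<-trans rest-fits (x∈p⇒∣p-x∣<∣p∣ (into here))
  where
    -- the remaining members of q avoid the image of the first one
    rest-fits : ∣ q ∣ ≤ ∣ p - g here ∣
    rest-fits = card-≤-injection q (p - g here) (λ i∈q → g (there i∈q))
      (λ i∈q → x∈p∧x≢y⇒x∈p-y (into (there i∈q)) (λ e → 0≢1+n (sym (inj (there i∈q) here e))))
      (λ i∈q j∈q e → suc-injective (inj (there i∈q) (there j∈q) e))

injection⇒≤∣∣ : ∀ {a n} (f : Fin a → Fin n) → Injective f →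
  (p : Subset n) → (∀ i → f i ∈ p) → a ≤ ∣ p ∣
injection⇒≤∣∣ {a} f f-inj p into =
  subst (_≤ ∣ p ∣) (∣⊤∣≡n a)
    (card-≤-injection ⊤ p (λ {i} _ → f i) (λ {i} _ → into i) (λ {i} {j} _ _ → f-inj i j))

∈-tabulate⁻ : ∀ {n} (f : Fin n → _) (i : Fin n) → i ∈ tabulate f → f i ≡ true
∈-tabulate⁻ f i i∈ = trans (sym (lookup∘tabulate f i)) ([]=⇒lookup i∈)

∈-tabulate⁺ : ∀ {n} (f : Fin n → _) (i : Fin n) → f i ≡ true → i ∈ tabulate f
∈-tabulate⁺ f i fi = lookup⇒[]= i (tabulate f) (trans (lookup∘tabulate f i) fi)

∈-colorNodes⁻ : ∀ {N nc} (c : Fin N → Fin nc) (Cc : Subset nc) {v} →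
  v ∈ colorNodes c Cc → c v ∈ Cc
∈-colorNodes⁻ c Cc {v} v∈ = lookup⇒[]= (c v) Cc (∈-tabulate⁻ _ v v∈)

∈-colorNodes⁺ : ∀ {N nc} (c : Fin N → Fin nc) (Cc : Subset nc) {v} →
  c v ∈ Cc → v ∈ colorNodes c Cc
∈-colorNodes⁺ c Cc {v} cv∈ = ∈-tabulate⁺ _ v ([]=⇒lookup cv∈)

has-preimage : ∀ {m n} (f : Fin m → Fin n) (X : Subset m) (j : Fin n) →
  Dec (∃ λ v → v ∈ X × f v ≡ j)
has-preimage f X j = any? (λ v → (v ∈? X) ×-dec (f v ≟ j))

image : ∀ {m n} (f : Fin m → Fin n) → Subset m → Subset n
image f X = tabulate (λ j → isYes (has-preimage f X j))

∈-image⁺ : ∀ {m n} (f : Fin m → Fin n) (X : Subset m) {v} → v ∈ X → f v ∈ image f X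
∈-image⁺ f X {v} v∈X =
  ∈-tabulate⁺ _ (f v) (Equivalence.to T-≡ (fromWitness {a? = has-preimage f X (f v)} (v , v∈X , refl)))

∈-image⁻ : ∀ {m n} (f : Fin m → Fin n) (X : Subset m) {j} →
  j ∈ image f X → ∃ λ v → v ∈ X × f v ≡ j
∈-image⁻ f X {j} j∈ = toWitness {a? = has-preimage f X j} (Equivalence.from T-≡ (∈-tabulate⁻ _ j j∈))

-- An image is no larger than its source: pick one preimage of each member.
∣image∣≤ : ∀ {m n} (f : Fin m → Fin n) (X : Subset m) → ∣ image f X ∣ ≤ ∣ X ∣
∣image∣≤ f X = card-≤-injection (image f X) X preimage preimage∈X preimage-injective
  where
    preimage : ∀ {j} → j ∈ image f X → Fin _
    preimage j∈ = proj₁ (∈-image⁻ f X j∈)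

    preimage∈X : ∀ {j} (j∈ : j ∈ image f X) → preimage j∈ ∈ X
    preimage∈X j∈ = proj₁ (proj₂ (∈-image⁻ f X j∈))

    f∘preimage : ∀ {j} (j∈ : j ∈ image f X) → f (preimage j∈) ≡ j
    f∘preimage j∈ = proj₂ (proj₂ (∈-image⁻ f X j∈))

    preimage-injective : ∀ {i j} (i∈ : i ∈ image f X) (j∈ : j ∈ image f X) →
      preimage i∈ ≡ preimage j∈ → i ≡ j
    preimage-injective i∈ j∈ e = trans (sym (f∘preimage i∈)) (trans (cong f e) (f∘preimage j∈))

enlarge : ∀ {n} (p : Subset n) {j} → ∣ p ∣ ≤ j → j ≤ n →
  Σ (Subset n) λ q → p ⊆ q × ∣ q ∣ ≡ j
enlarge [] {zero} _ _ = [] , (λ i∈ → i∈) , refl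
enlarge (inside ∷ p) {suc j} (s≤s p≤j) (s≤s j≤n) with enlarge p p≤j j≤n
... | q , p⊆q , ∣q∣≡j = inside ∷ q , in⊆in p⊆q , cong suc ∣q∣≡j
enlarge {suc n} (outside ∷ p) {j} p≤j j≤1+n with j ≤? n
... | yes j≤n with enlarge p p≤j j≤n
...   | q , p⊆q , ∣q∣≡j = outside ∷ q , out⊆ p⊆q , ∣q∣≡j
enlarge {suc n} (outside ∷ p) {suc j} p≤j (s≤s j≤n) | no j≰n
  with enlarge p (≤-trans (∣p∣≤n p) (m<1+n⇒m≤n (≰⇒> j≰n))) j≤n
...   | q , p⊆q , ∣q∣≡j = inside ∷ q , out⊆ p⊆q , cong suc ∣q∣≡j
enlarge {suc n} (outside ∷ p) {zero} _ _ | no 0≰n = contradiction z≤n 0≰n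

nodeCut-meets-path : ∀ {N} {G : Graph N} {s t : Fin N} {X : Subset N} →
  IsNodeCut G s t X → (p : STPath G s t) → ∃ λ v → v List.∈ inner p × v ∈ X
nodeCut-meets-path {X = X} (_ , _ , separates) p
  with List.find (¬All⇒Any¬ (λ v → ¬? (v ∈? X)) (inner p)
                    (λ avoids → separates (inner p , linked p , avoids)))
... | v , v∈p , ¬v∉X = v , v∈p , decidable-stable (v ∈? X) ¬v∉X

colorCut-contains-pathColor : ∀ {N nc} {G : Graph N} {s t : Fin N}
  {c : Fin N → Fin nc} {D : Subset nc} → IsColorCut G s t c D →
  (p : STPath G s t) (a : Fin nc) → (∀ v → v List.∈ inner p → c v ≡ a) → a ∈ D
colorCut-contains-pathColor {c = c} {D} (Y , Y-cut , Y⊆) p a mono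
  with nodeCut-meets-path Y-cut p
... | v , v∈p , v∈Y = subst (_∈ D) (mono v v∈p) (∈-colorNodes⁻ c D (Y⊆ v∈Y))

colorCut-≥ : ∀ {N k nc} {G : Graph N} {s t : Fin N} (P : Fin k → STPath G s t)
  {c : Fin N → Fin nc} → PathBasedColoring P c →
  ∀ {D} → IsColorCut G s t c D → k ⊓ nc ≤ ∣ D ∣
colorCut-≥ {k = k} {nc} P (col , col-on-paths , distinct-if-enough , distinct-subfamily) {D} D-cut
  with k ≤? nc
... | yes k≤nc = subst (_≤ ∣ D ∣) (sym (m≤n⇒m⊓n≡m k≤nc))
                   (injection⇒≤∣∣ col (distinct-if-enough k≤nc) D pathColor∈D)
  where
    pathColor∈D : ∀ i → col i ∈ D
    pathColor∈D i = colorCut-contains-pathColor D-cut (P i) (col i) (col-on-paths i)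
... | no k≰nc with distinct-subfamily (≰⇒> k≰nc)
...   | ι , _ , distinct = ≤-trans (m⊓n≤n k nc)
                             (injection⇒≤∣∣ (λ x → col (ι x)) distinct D pathColor∈D)
  where
    pathColor∈D : ∀ x → col (ι x) ∈ D
    pathColor∈D x = colorCut-contains-pathColor D-cut (P (ι x)) (col (ι x)) (col-on-paths (ι x))

-- Upper bound: a node cut X yields color cuts of every size j with
-- ∣ X ∣ ⊓ nc ≤ j ≤ nc, namely enlargements of the color image c[X].
colorCut-of-size : ∀ {N nc} {G : Graph N} {s t : Fin N} (c : Fin N → Fin nc)
  {X : Subset N} → IsNodeCut G s t X → ∀ {j} → ∣ X ∣ ⊓ nc ≤ j → j ≤ nc →
  Σ (Subset nc) λ D → IsColorCut G s t c D × ∣ D ∣ ≡ j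
colorCut-of-size {nc = nc} c {X} X-cut X⊓nc≤j j≤nc
  with enlarge (image c X) (≤-trans small-image X⊓nc≤j) j≤nc
  where
    small-image : ∣ image c X ∣ ≤ ∣ X ∣ ⊓ nc
    small-image = ⊓-glb (∣image∣≤ c X) (∣p∣≤n (image c X))
... | D , image⊆D , ∣D∣≡j =
  D , (X , X-cut , λ v∈X → ∈-colorNodes⁺ c D (image⊆D (∈-image⁺ c X v∈X))) , ∣D∣≡j

theorem5 : ∀ {N : ℕ} (G : Graph N) (s t : Fin N) → s ≢ t → ¬ Adj G s t →
    ∀ (k : ℕ) → NodeConnectivity G s t k →
    ∀ (nc : ℕ) (P : Fin k → STPath G s t) → InternallyDisjoint P →
    ∀ (c : Fin N → Fin nc) → PathBasedColoring P c →
    MinColorCutValue G s t c (k ⊓ nc)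
theorem5 G s t _ _ k ((X , X-cut , ∣X∣≡k) , _) nc P _ c coloring =
  colorCut-of-size {G = G} c X-cut (≤-reflexive (cong (_⊓ nc) ∣X∣≡k)) (m⊓n≤n k nc) ,
  λ { _ (D , D-cut , refl) → colorCut-≥ P coloring {D} D-cut }
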